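{- Let $\mathcal{D}_h,\mathcal{D}_l$ be NDBATs, $m$ an NDBAT refinement mapping from $\mathcal{D}_h$ to $\mathcal{D}_l$ proper wrt $\mathcal{D}_l$, $M_h\models\mathcal{D}_h\cup\mathcal{C}$, $M_l\models\mathcal{D}_l\cup\mathcal{C}$, and suppose $M_h\sim_m M_l$. Then for any sequence $\vec\alpha$ of high-level system actions, any high-level situation-suppressed formula $\phi$ and any variable assignment $v$: $M_l,v\models\exists s'.Do(m_s(\vec\alpha),S_0,s')\wedge m_f(\phi)[s']$ if and only if $M_h,v\models Executable(do(\vec\alpha,S_0))\wedge\phi[do(\vec\alpha,S_0)]$.
   Context: Framework: the situation calculus. Situations: $S_0$ and $do(a,s)$; $do([a_1,\dots,a_n],s)$ abbreviates $do(a_n,\dots do(a_1,s)\dots)$. $Executable(s)$ means every action performed in reaching $s$ was possible when performed. A situation-suppressed formula is one with situation arguments of fluents removed; $\phi[s]$ restores $s$. $M,v\models\phi$: model $M$ and variable assignment $v$ satisfy $\phi$; $v[x/d]$ is $v$ modified at $x$. $\vec\alpha$ may contain free variables in action parameters, but its action function symbols are given. NDBAT: a basic action theory (foundational axioms, initial-state axioms, unique-name axioms for actions, successor state axioms, precondition axioms $Poss(A(\vec x,e),s)\equiv\phi^{Poss}_A(\vec x,e,s)$) in which every action function $A(\vec x,e)$ has a final argument $e$ of sort Reaction. $A(\vec x,e)$ is a system action, $A(\vec x)$ the agent action, with agent precondition $Poss_{ag}(A(\vec x),s)$; the theory entails $\forall e.Poss(A(\vec x,e),s)\supset Poss_{ag}(A(\vec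 x),s)$ and $Poss_{ag}(A(\vec x),s)\supset\exists e.Poss(A(\vec x,e),s)$. ConGolog programs $\delta::=\alpha\mid\varphi?\mid\delta_1;\delta_2\mid\delta_1|\delta_2\mid\pi x.\delta\mid\delta^*\mid\delta_1\|\delta_2$ ($nil=True?$). $\mathcal{C}$ axiomatizes $Trans,Final$: $Trans(\alpha,s,\delta',s')\equiv s'=do(\alpha,s)\wedge Poss(\alpha,s)\wedge\delta'=True?$; $Trans(\varphi?,s,\delta',s')\equiv False$; $Trans(\delta_1;\delta_2,s,\delta',s')\equiv(Trans(\delta_1,s,\delta_1',s')\wedge\delta'=\delta_1';\delta_2)\vee(Final(\delta_1,s)\wedge Trans(\delta_2,s,\delta',s'))$; choice: disjunction; $\pi$: existential; $Trans(\delta^*,s,\delta',s')\equiv Trans(\delta,s,\delta'',s')\wedge\delta'=\delta'';\delta^*$; $\|$: interleaving. $Final(\alpha,s)\equiv False$, $Final(\varphi?,s)\equiv\varphi[s]$, sequence and $\|$: conjunction, choice: disjunction, $\pi$: existential, $Final(\delta^*,s)\equiv True$. $Do(\delta,s,s')\doteq\exists\delta'.Trans^*(\delta,s,\delta',s')\wedge Final(\delta',s')$. Agent programs (atoms are agent actions) use $Trans(A(\vec x),s,\delta',s')\equiv\exists e.Poss(A(\vec x,e),s)\wedge\delta'=True?\wedge s'=do(A(\vec x,e),s)$; $Do_{ag}$ is $Do$ under this semantics. SD: $Trans^*(\delta,s,\delta',s')\wedge Trans^*(\delta,s,\delta'',s')\supset\delta'=\delta''$. Abstraction setting: high-level NDBAT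 $\mathcal{D}_h$ (finite action types $\mathcal{A}_h$, fluents $\mathcal{F}_h$), low-level NDBAT $\mathcal{D}_l$, sharing only a countably infinite set of standard object names (unique names, domain closure; Reaction a subsort of Object); no functions other than constants, no non-fluent predicates. A refinement mapping $m=\langle m_a,m_s,m_f\rangle$ maps each $A\in\mathcal{A}_h$ to an SD low-level agent program $m_a(A(\vec x))$ and an SD low-level system program $m_s(A(\vec x,e))$, and each high-level fluent $F(\vec x)$ to a situation-suppressed low-level formula $m_f(F(\vec x))$; extended to sequences by composition with ";" ($m(\epsilon)=nil$), and to formulas: $m_f(\phi)$ replaces each high-level fluent by its image. Proper wrt $\mathcal{D}_l$: for all high-level system action sequences $\vec\alpha$ and $A$, $\mathcal{D}_l\cup\mathcal{C}\models\forall s.(Do(m_s(\vec\alpha),S_0,s)\supset\forall\vec x,s'.(Do_{ag}(m_a(A(\vec x)),s,s')\equiv\exists e.Do(m_s(A(\vec x,e)),s,s')))$. $s_h\sim_m^{M_h,M_l}s_l$ iff for every $F\in\mathcal{F}_h$ and assignment $v$: $M_h,v[s/s_h]\models F(\vec x,s)$ iff $M_l,v[s/s_l]\models m_f(F(\vec x))[s]$. An $m$-bisimulation $B$ satisfies, for $\langle s_h,s_l\rangle\in B$: (i) $s_h\sim_m^{M_h,M_l}s_l$; (ii) for each $A\in\mathcal{A}_h$, if $M_h,v[s/s_h,s'/s_h']\models Poss(A(\vec x,e),s)\wedge s'=do(A(\vec x,e),s)$ then some $s_l'$ has $M_l,v[s/s_l,s'/s_l']\models Do(m_s(A(\vec x,e)),s,s')$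 and $\langle s_h',s_l'\rangle\in B$; (iii) conversely from $Do(m_s(A(\vec x,e)),s_l,s_l')$ to some $s_h'=do(A(\vec x,e),s_h)$ with $Poss$ and $\langle s_h',s_l'\rangle\in B$. $M_h\sim_m M_l$ iff some $m$-bisimulation relates $S_0^{M_h}$ and $S_0^{M_l}$. -}

module Defs where

open import Data.Nat using (ℕ; zero; suc)
open import Data.Fin using (Fin; zero; suc)
open import Data.Vec using (Vec; []; _∷_; lookup) renaming (map to vmap)
open import Data.List using (List; []; _∷_; foldl) renaming (map to lmap)
open import Data.Product using (Σ; _×_; _,_)
open import Data.Sum using (_⊎_)
open import Data.Bool using (Bool; true; false)
open import Data.Unit using (⊤; tt)
open import Data.Empty using (⊥)
open import Relation.Binary.PropositionalEquality using (_≡_)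
open import Relation.Nullary using (¬_)
open import Function.Bundles using (_⇔_)

-- Signatures (action function symbols with their object arity, fluents)
-- A system action A(x⃗,e) has arity arA A objects plus one reaction e.

record Sig : Set₁ where
  field
    Act : Set
    arA : Act → ℕ
    Flu : Set
    arF : Flu → ℕ
open Sig public

finSig : (na nf : ℕ) → (Fin na → ℕ) → (Fin nf → ℕ) → Sig
finSig na nf aA aF = record { Act = Fin na ; arA = aA ; Flu = Fin nf ; arF = aF }

-- Terms: well-scoped de Bruijn variables, or standard names (ℕ)

data Term (n : ℕ) : Set where
  var : Fin n → Term n
  nm  : ℕ → Term n

Env : ℕ → Set
Env n = Fin n → ℕ

_∷ₑ_ : {n : ℕ} → ℕ → Env n → Env (suc n)
(d ∷ₑ v) zero    = d
(d ∷ₑ v) (suc i) = v i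

evT : {n : ℕ} → Env n → Term n → ℕ
evT v (var i) = v i
evT v (nm c)  = c

Subst : ℕ → ℕ → Set
Subst n m = Fin n → Term m

wkT : {m : ℕ} → Term m → Term (suc m)
wkT (var i) = var (suc i)
wkT (nm c)  = nm c

liftS : {n m : ℕ} → Subst n m → Subst (suc n) (suc m)
liftS σ zero    = var zero
liftS σ (suc i) = wkT (σ i)

substT : {n m : ℕ} → Subst n m → Term n → Term m
substT σ (var i) = σ i
substT σ (nm c)  = nm c

groundS : {n : ℕ} → Env n → Subst n 0
groundS v i = nm (v i)

sub0S : {n : ℕ} → ℕ → Subst (suc n) n
sub0S d zero    = nm d
sub0S d (suc i) = var i

-- Situation-suppressed formulas (first-order, quantification over objects)

data Fm (S : Sig) (n : ℕ) : Set where
  ⊤ₘ   : Fm S n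
  flu  : (F : Flu S) → Vec (Term n) (arF S F) → Fm S n
  _≐_  : Term n → Term n → Fm S n
  ¬ₘ   : Fm S n → Fm S n
  _∧ₘ_ : Fm S n → Fm S n → Fm S n
  ∃ₘ   : Fm S (suc n) → Fm S n

substF : {S : Sig} {n m : ℕ} → Subst n m → Fm S n → Fm S m
substF σ ⊤ₘ          = ⊤ₘ
substF σ (flu F ts)  = flu F (vmap (substT σ) ts)
substF σ (t ≐ u)     = substT σ t ≐ substT σ u
substF σ (¬ₘ φ)      = ¬ₘ (substF σ φ)
substF σ (φ ∧ₘ ψ)    = substF σ φ ∧ₘ substF σ ψ
substF σ (∃ₘ φ)      = ∃ₘ (substF (liftS σ) φ)

-- Standard situations: finite sequences of ground system actions A(d⃗,e).
-- do(a,s) = a ∷ s, S₀ = [].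

record GAct (S : Sig) : Set where
  constructor _⟨_,_⟩
  field
    gA   : Act S
    gArg : Vec ℕ (arA S gA)
    gRx  : ℕ

data Sit (S : Sig) : Set where
  S₀  : Sit S
  doA : GAct S → Sit S → Sit S

-- do([a₁,…,aₖ],s) = do(aₖ,…do(a₁,s)…)
doL : {S : Sig} → List (GAct S) → Sit S → Sit S
doL []       s = s
doL (a ∷ as) s = doL as (doA a s)

record Model (S : Sig) : Set₁ where
  field
    Holds  : (F : Flu S) → Vec ℕ (arF S F) → Sit S → Set
    Poss   : GAct S → Sit S → Set
    PossAg : (A : Act S) → Vec ℕ (arA S A) → Sit S → Set
open Model public

Sat : {S : Sig} {n : ℕ} → Model S → Env n → Sit S → Fm S n → Set
Sat M v s ⊤ₘ         = ⊤
Sat M v s (flu F ts) = Holds M F (vmap (evT v) ts) s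
Sat M v s (t ≐ u)    = evT v t ≡ evT v u
Sat M v s (¬ₘ φ)     = ¬ Sat M v s φ
Sat M v s (φ ∧ₘ ψ)   = Sat M v s φ × Sat M v s ψ
Sat M v s (∃ₘ φ)     = Σ ℕ (λ d → Sat M (d ∷ₑ v) s φ)

env0 : Env 0
env0 ()

data Executable {S : Sig} (M : Model S) : Sit S → Set where
  exS₀ : Executable M S₀
  exDo : {a : GAct S} {s : Sit S} → Executable M s → Poss M a s → Executable M (doA a s)

-- Theories, identified with their classes of models (of D ∪ C)
Theory : Sig → Set₁
Theory S = Model S → Set

IsNDBAT : {S : Sig} → Theory S → Set₁
IsNDBAT {S} T = (M : Model S) → T M →
  ((A : Act S) (ds : Vec ℕ (arA S A)) (e : ℕ) (s : Sit S) →
      Poss M (A ⟨ ds , e ⟩) s → PossAg M A ds s)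
  × ((A : Act S) (ds : Vec ℕ (arA S A)) (s : Sit S) →
      PossAg M A ds s → Σ ℕ (λ e → Poss M (A ⟨ ds , e ⟩) s))

-- ConGolog programs. sys = true: system program (atoms A(t⃗,t_e));
-- sys = false: agent program (atoms A(t⃗)).

Rx : Bool → ℕ → Set
Rx true  n = Term n
Rx false n = ⊤

data Prog (S : Sig) (sys : Bool) (n : ℕ) : Set where
  act   : (A : Act S) → Vec (Term n) (arA S A) → Rx sys n → Prog S sys n
  _¿    : Fm S n → Prog S sys n
  _；_  : Prog S sys n → Prog S sys n → Prog S sys n
  _∣_   : Prog S sys n → Prog S sys n → Prog S sys n
  π     : Prog S sys (suc n) → Prog S sys n
  _*    : Prog S sys n → Prog S sys n
  _∥_   : Prog S sys n → Prog S sys n → Prog S sys n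

nil : {S : Sig} {b : Bool} {n : ℕ} → Prog S b n
nil = ⊤ₘ ¿

substR : {b : Bool} {n m : ℕ} → Subst n m → Rx b n → Rx b m
substR {true}  σ t  = substT σ t
substR {false} σ tt = tt

substP : {S : Sig} {b : Bool} {n m : ℕ} → Subst n m → Prog S b n → Prog S b m
substP σ (act A ts r) = act A (vmap (substT σ) ts) (substR σ r)
substP σ (φ ¿)        = substF σ φ ¿
substP σ (δ ； γ)     = substP σ δ ； substP σ γ
substP σ (δ ∣ γ)      = substP σ δ ∣ substP σ γ
substP σ (π δ)        = π (substP (liftS σ) δ)
substP σ (δ *)        = substP σ δ *
substP σ (δ ∥ γ)      = substP σ δ ∥ substP σ γ

Step : {S : Sig} {b : Bool} → Model S → (A : Act S) → Vec ℕ (arA S A) →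
       Rx b 0 → Sit S → Sit S → Set
Step {b = true}  M A ds t  s s' =
  Poss M (A ⟨ ds , evT env0 t ⟩) s × s' ≡ doA (A ⟨ ds , evT env0 t ⟩) s
Step {b = false} M A ds tt s s' =
  Σ ℕ (λ e → Poss M (A ⟨ ds , e ⟩) s × s' ≡ doA (A ⟨ ds , e ⟩) s)

module _ {S : Sig} {b : Bool} (M : Model S) where

  data Final : Prog S b 0 → Sit S → Set where
    fTest : {φ : Fm S 0} {s : Sit S} → Sat M env0 s φ → Final (φ ¿) s
    fSeq  : {δ γ : Prog S b 0} {s : Sit S} → Final δ s → Final γ s → Final (δ ； γ) s
    fCh₁  : {δ γ : Prog S b 0} {s : Sit S} → Final δ s → Final (δ ∣ γ) s
    fCh₂  : {δ γ : Prog S b 0} {s : Sit S} → Final γ s → Final (δ ∣ γ) s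
    fPi   : {δ : Prog S b 1} {s : Sit S} (d : ℕ) → Final (substP (sub0S d) δ) s → Final (π δ) s
    fStar : {δ : Prog S b 0} {s : Sit S} → Final (δ *) s
    fPar  : {δ γ : Prog S b 0} {s : Sit S} → Final δ s → Final γ s → Final (δ ∥ γ) s

  data Trans : Prog S b 0 → Sit S → Prog S b 0 → Sit S → Set where
    tAct  : {A : Act S} {ts : Vec (Term 0) (arA S A)} {r : Rx b 0} {s s' : Sit S} →
            Step M A (vmap (evT env0) ts) r s s' → Trans (act A ts r) s nil s'
    tSeq₁ : {δ δ' γ : Prog S b 0} {s s' : Sit S} →
            Trans δ s δ' s' → Trans (δ ； γ) s (δ' ； γ) s'
    tSeq₂ : {δ γ γ' : Prog S b 0} {s s' : Sit S} →
            Final δ s → Trans γ s γ' s' → Trans (δ ； γ) s γ' s'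
    tCh₁  : {δ γ δ' : Prog S b 0} {s s' : Sit S} → Trans δ s δ' s' → Trans (δ ∣ γ) s δ' s'
    tCh₂  : {δ γ δ' : Prog S b 0} {s s' : Sit S} → Trans γ s δ' s' → Trans (δ ∣ γ) s δ' s'
    tPi   : {δ : Prog S b 1} {δ' : Prog S b 0} {s s' : Sit S} (d : ℕ) →
            Trans (substP (sub0S d) δ) s δ' s' → Trans (π δ) s δ' s'
    tStar : {δ δ' : Prog S b 0} {s s' : Sit S} →
            Trans δ s δ' s' → Trans (δ *) s (δ' ； (δ *)) s'
    tPar₁ : {δ γ δ' : Prog S b 0} {s s' : Sit S} →
            Trans δ s δ' s' → Trans (δ ∥ γ) s (δ' ∥ γ) s'
    tPar₂ : {δ γ γ' : Prog S b 0} {s s' : Sit S} →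
            Trans γ s γ' s' → Trans (δ ∥ γ) s (δ ∥ γ') s'

  data Trans* : Prog S b 0 → Sit S → Prog S b 0 → Sit S → Set where
    t*refl : {δ : Prog S b 0} {s : Sit S} → Trans* δ s δ s
    t*step : {δ δ' δ'' : Prog S b 0} {s s' s'' : Sit S} →
             Trans δ s δ' s' → Trans* δ' s' δ'' s'' → Trans* δ s δ'' s''

  DoC : Prog S b 0 → Sit S → Sit S → Set
  DoC δ s s' = Σ (Prog S b 0) (λ δ' → Trans* δ s δ' s' × Final δ' s')

-- M , v ⊨ Do(δ,s,s') (Do_ag when b = false), δ with free variables under v
Do : {S : Sig} {b : Bool} {n : ℕ} → Model S → Env n → Prog S b n → Sit S → Sit S → Set
Do M v δ s s' = DoC M (substP (groundS v) δ) s s'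

IsSD : {S : Sig} {b : Bool} {n : ℕ} → Theory S → Prog S b n → Set₁
IsSD {S} {b} {n} T δ = (M : Model S) → T M → (v : Env n) (s s' : Sit S)
  (δ' δ'' : Prog S b 0) →
  Trans* M (substP (groundS v) δ) s δ' s' →
  Trans* M (substP (groundS v) δ) s δ'' s' → δ' ≡ δ''

-- Refinement mappings.
-- ma A : agent program with free variables x⃗ = var 0 … var (k-1) (k = arA A)
-- ms A : system program with free variables e = var 0, x⃗ = var 1 … var k
-- mf F : low-level formula with free variables x⃗ = var 0 … var (arF F - 1)

record RefMap (H L : Sig) : Set where
  field
    ma : (A : Act H) → Prog L false (arA H A)
    ms : (A : Act H) → Prog L true (suc (arA H A))
    mf : (F : Flu H) → Fm L (arF H F)
open RefMap public

IsSDMap : {H L : Sig} → Theory L → RefMap H L → Set₁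
IsSDMap {H} T m = (A : Act H) → IsSD T (ma m A) × IsSD T (ms m A)

HAct : Sig → ℕ → Set
HAct H n = Σ (Act H) (λ A → Vec (Term n) (arA H A) × Term n)

groundA : {H : Sig} {n : ℕ} → Env n → HAct H n → GAct H
groundA v (A , ts , e) = A ⟨ vmap (evT v) ts , evT v e ⟩

actS : {H : Sig} {n : ℕ} (A : Act H) → Vec (Term n) (arA H A) → Term n → Subst (suc (arA H A)) n
actS A ts e zero    = e
actS A ts e (suc i) = lookup ts i

msAct : {H L : Sig} {n : ℕ} → RefMap H L → HAct H n → Prog L true n
msAct {H} m (A , ts , e) = substP (actS {H} A ts e) (ms m A)

msSeq : {H L : Sig} {n : ℕ} → RefMap H L → List (HAct H n) → Prog L true n
msSeq m αs = foldl (λ δ α → δ ； msAct m α) nil αs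

mfF : {H L : Sig} {n : ℕ} → RefMap H L → Fm H n → Fm L n
mfF m ⊤ₘ          = ⊤ₘ
mfF m (flu F ts)  = substF (lookup ts) (mf m F)
mfF m (t ≐ u)     = t ≐ u
mfF m (¬ₘ φ)      = ¬ₘ (mfF m φ)
mfF m (φ ∧ₘ ψ)    = mfF m φ ∧ₘ mfF m ψ
mfF m (∃ₘ φ)      = ∃ₘ (mfF m φ)

Proper : {H L : Sig} → Theory L → RefMap H L → Set₁
Proper {H} {L} T m = (M : Model L) → T M → (n : ℕ) (αs : List (HAct H n)) (v : Env n)
  (s : Sit L) → Do M v (msSeq m αs) S₀ s →
  (A : Act H) (xs : Vec ℕ (arA H A)) (s' : Sit L) →
  Do M (lookup xs) (ma m A) s s' ⇔ Σ ℕ (λ e → Do M (e ∷ₑ lookup xs) (ms m A) s s')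

module _ {H L : Sig} (m : RefMap H L) (Mh : Model H) (Ml : Model L) where

  Sim : Sit H → Sit L → Set
  Sim sh sl = (F : Flu H) (xs : Vec ℕ (arF H F)) →
    Holds Mh F xs sh ⇔ Sat Ml (lookup xs) sl (mf m F)

  IsBisim : (Sit H → Sit L → Set) → Set
  IsBisim B = (sh : Sit H) (sl : Sit L) → B sh sl →
    Sim sh sl
    × ((A : Act H) (xs : Vec ℕ (arA H A)) (e : ℕ) →
        Poss Mh (A ⟨ xs , e ⟩) sh →
        Σ (Sit L) (λ sl' → Do Ml (e ∷ₑ lookup xs) (ms m A) sl sl' × B (doA (A ⟨ xs , e ⟩) sh) sl'))
    × ((A : Act H) (xs : Vec ℕ (arA H A)) (e : ℕ) (sl' : Sit L) →
        Do Ml (e ∷ₑ lookup xs) (ms m A) sl sl' →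
        Poss Mh (A ⟨ xs , e ⟩) sh × B (doA (A ⟨ xs , e ⟩) sh) sl')

  Bisimilar : Set₁
  Bisimilar = Σ (Sit H → Sit L → Set) (λ B → IsBisim B × B S₀ S₀)

-- A bisimulation lets every executable high-level run be simulated by a
-- run of its refinement, and every run of a refinement be matched by an
-- executable high-level run, the two end situations again being bisimilar.
-- Bisimilar situations agree on every fluent F and its image m_f(F), hence,
-- by induction on formulas, on every φ and m_f(φ).
module Submission where

open import Defs
open import Data.Nat using (ℕ)
open import Data.Fin using (Fin; zero; suc)
open import Data.List using (List; []; _∷_; foldl) renaming (map to lmap)
open import Data.Vec using (Vec; lookup) renaming (map to vmap)
open import Data.Vec.Properties using (map-∘; map-cong; lookup-map)
open import Data.Product using (Σ; _×_; _,_; proj₁; proj₂; map₂)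
open import Data.Bool using (Bool; true; false)
open import Data.Unit using (tt)
open import Function using (_∘_)
open import Function.Bundles using (_⇔_; mk⇔; Equivalence)
open import Function.Construct.Identity using (⇔-id)
open import Function.Construct.Symmetry using (⇔-sym)
open import Function.Construct.Composition using (_⇔-∘_)
open import Function.Related.Propositional using (≡⇒; equivalence)
open import Function.Related.TypeIsomorphisms using (¬-cong-⇔)
open import Data.Product.Function.NonDependent.Propositional using (_×-⇔_)
open import Relation.Binary.PropositionalEquality

private
  ≡⇒⇔ : {A B : Set} → A ≡ B → A ⇔ B
  ≡⇒⇔ = ≡⇒ {k = equivalence}

  Σ-⇔ : {A : Set} {P Q : A → Set} → (∀ a → P a ⇔ Q a) → Σ A P ⇔ Σ A Q
  Σ-⇔ P⇔Q = mk⇔ (map₂ (Equivalence.to (P⇔Q _))) (map₂ (Equivalence.from (P⇔Q _)))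

substT-fusion : {n k l : ℕ} {σ : Subst n k} {τ : Subst k l} {ρ : Subst n l} →
  substT τ ∘ σ ≗ ρ → substT τ ∘ substT σ ≗ substT ρ
substT-fusion τσ≗ρ (var i) = τσ≗ρ i
substT-fusion τσ≗ρ (nm c)  = refl

liftS-fusion : {n k l : ℕ} {σ : Subst n k} {τ : Subst k l} {ρ : Subst n l} →
  substT τ ∘ σ ≗ ρ → substT (liftS τ) ∘ liftS σ ≗ liftS ρ
liftS-fusion         τσ≗ρ zero    = refl
liftS-fusion {σ = σ} τσ≗ρ (suc i) with σ i | τσ≗ρ i
... | var j | eq = cong wkT eq
... | nm c  | eq = cong wkT eq

vmap-substT-fusion : {n k l a : ℕ} {σ : Subst n k} {τ : Subst k l} {ρ : Subst n l} →
  substT τ ∘ σ ≗ ρ → (ts : Vec (Term n) a) → vmap (substT τ) (vmap (substT σ) ts) ≡ vmap (substT ρ) ts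
vmap-substT-fusion {σ = σ} {τ} τσ≗ρ ts =
  trans (sym (map-∘ (substT τ) (substT σ) ts)) (map-cong (substT-fusion τσ≗ρ) ts)

substF-fusion : {S : Sig} {n k l : ℕ} {σ : Subst n k} {τ : Subst k l} {ρ : Subst n l} →
  substT τ ∘ σ ≗ ρ → (φ : Fm S n) → substF τ (substF σ φ) ≡ substF ρ φ
substF-fusion τσ≗ρ ⊤ₘ         = refl
substF-fusion τσ≗ρ (flu F ts) = cong (flu F) (vmap-substT-fusion τσ≗ρ ts)
substF-fusion τσ≗ρ (t ≐ u)    = cong₂ _≐_ (substT-fusion τσ≗ρ t) (substT-fusion τσ≗ρ u)
substF-fusion τσ≗ρ (¬ₘ φ)     = cong ¬ₘ (substF-fusion τσ≗ρ φ)
substF-fusion τσ≗ρ (φ ∧ₘ ψ)   = cong₂ _∧ₘ_ (substF-fusion τσ≗ρ φ) (substF-fusion τσ≗ρ ψ)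
substF-fusion τσ≗ρ (∃ₘ φ)     = cong ∃ₘ (substF-fusion (liftS-fusion τσ≗ρ) φ)

substR-fusion : {b : Bool} {n k l : ℕ} {σ : Subst n k} {τ : Subst k l} {ρ : Subst n l} →
  substT τ ∘ σ ≗ ρ → (r : Rx b n) → substR τ (substR σ r) ≡ substR ρ r
substR-fusion {true}  τσ≗ρ t  = substT-fusion τσ≗ρ t
substR-fusion {false} τσ≗ρ tt = refl

substP-fusion : {S : Sig} {b : Bool} {n k l : ℕ} {σ : Subst n k} {τ : Subst k l} {ρ : Subst n l} →
  substT τ ∘ σ ≗ ρ → (δ : Prog S b n) → substP τ (substP σ δ) ≡ substP ρ δ
substP-fusion τσ≗ρ (act A ts r) = cong₂ (act A) (vmap-substT-fusion τσ≗ρ ts) (substR-fusion τσ≗ρ r)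
substP-fusion τσ≗ρ (φ ¿)        = cong _¿ (substF-fusion τσ≗ρ φ)
substP-fusion τσ≗ρ (δ ； γ)     = cong₂ _；_ (substP-fusion τσ≗ρ δ) (substP-fusion τσ≗ρ γ)
substP-fusion τσ≗ρ (δ ∣ γ)      = cong₂ _∣_ (substP-fusion τσ≗ρ δ) (substP-fusion τσ≗ρ γ)
substP-fusion τσ≗ρ (π δ)        = cong π (substP-fusion (liftS-fusion τσ≗ρ) δ)
substP-fusion τσ≗ρ (δ *)        = cong _* (substP-fusion τσ≗ρ δ)
substP-fusion τσ≗ρ (δ ∥ γ)      = cong₂ _∥_ (substP-fusion τσ≗ρ δ) (substP-fusion τσ≗ρ γ)

evT-substT : {n k : ℕ} {σ : Subst n k} {v : Env k} {w : Env n} →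
  w ≗ evT v ∘ σ → evT v ∘ substT σ ≗ evT w
evT-substT w≗vσ (var i) = sym (w≗vσ i)
evT-substT w≗vσ (nm c)  = refl

∷ₑ-liftS : {n k : ℕ} {σ : Subst n k} {v : Env k} {w : Env n} (d : ℕ) →
  w ≗ evT v ∘ σ → (d ∷ₑ w) ≗ evT (d ∷ₑ v) ∘ liftS σ
∷ₑ-liftS         d w≗vσ zero    = refl
∷ₑ-liftS {σ = σ} d w≗vσ (suc i) with σ i | w≗vσ i
... | var j | eq = eq
... | nm c  | eq = eq

Sat-substF : {S : Sig} {n k : ℕ} (M : Model S) (s : Sit S) {σ : Subst n k} {v : Env k} {w : Env n} →
  w ≗ evT v ∘ σ → (φ : Fm S n) → Sat M v s (substF σ φ) ⇔ Sat M w s φ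
Sat-substF M s w≗vσ ⊤ₘ         = ⇔-id _
Sat-substF M s {σ} {v} w≗vσ (flu F ts) = ≡⇒⇔ (cong (λ ds → Holds M F ds s)
  (trans (sym (map-∘ (evT v) (substT σ) ts)) (map-cong (evT-substT w≗vσ) ts)))
Sat-substF M s w≗vσ (t ≐ u)    = ≡⇒⇔ (cong₂ _≡_ (evT-substT w≗vσ t) (evT-substT w≗vσ u))
Sat-substF M s w≗vσ (¬ₘ φ)     = ¬-cong-⇔ (Sat-substF M s w≗vσ φ)
Sat-substF M s w≗vσ (φ ∧ₘ ψ)   = Sat-substF M s w≗vσ φ ×-⇔ Sat-substF M s w≗vσ ψ
Sat-substF M s w≗vσ (∃ₘ φ)     = Σ-⇔ (λ d → Sat-substF M s (∷ₑ-liftS d w≗vσ) φ)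

module _ {S : Sig} {b : Bool} (M : Model S) where

  Trans*-++ : {δ δ' δ'' : Prog S b 0} {s s' s'' : Sit S} →
    Trans* M δ s δ' s' → Trans* M δ' s' δ'' s'' → Trans* M δ s δ'' s''
  Trans*-++ t*refl         later = later
  Trans*-++ (t*step t ts) later = t*step t (Trans*-++ ts later)

  Trans*-；ˡ : {δ δ' γ : Prog S b 0} {s s' : Sit S} →
    Trans* M δ s δ' s' → Trans* M (δ ； γ) s (δ' ； γ) s'
  Trans*-；ˡ t*refl        = t*refl
  Trans*-；ˡ (t*step t ts) = t*step (tSeq₁ t) (Trans*-；ˡ ts)

  DoC-；-join : {δ γ : Prog S b 0} {s s' s'' : Sit S} →
    DoC M δ s s' → DoC M γ s' s'' → DoC M (δ ； γ) s s''
  DoC-；-join (δ' , δ→δ' , fδ') (γ' , t*refl , fγ') = δ' ； γ' , Trans*-；ˡ δ→δ' , fSeq fδ' fγ'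
  DoC-；-join (δ' , δ→δ' , fδ') (γ' , t*step t ts , fγ') =
    γ' , Trans*-++ (Trans*-；ˡ δ→δ') (t*step (tSeq₂ fδ' t) ts) , fγ'

  DoC-；-split : {δ γ ρ : Prog S b 0} {s s'' : Sit S} →
    Trans* M (δ ； γ) s ρ s'' → Final M ρ s'' → Σ (Sit S) (λ s' → DoC M δ s s' × DoC M γ s' s'')
  DoC-；-split t*refl (fSeq fδ fγ) = _ , (_ , t*refl , fδ) , (_ , t*refl , fγ)
  DoC-；-split (t*step (tSeq₁ t) ts) fρ with DoC-；-split ts fρ
  ... | s' , (δ' , δ→δ' , fδ') , doγ = s' , (δ' , t*step t δ→δ' , fδ') , doγ
  DoC-；-split (t*step (tSeq₂ fδ t) ts) fρ = _ , (_ , t*refl , fδ) , (_ , t*step t ts , fρ)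

  DoC-； : {δ γ : Prog S b 0} {s s'' : Sit S} →
    DoC M (δ ； γ) s s'' ⇔ Σ (Sit S) (λ s' → DoC M δ s s' × DoC M γ s' s'')
  DoC-； = mk⇔ (λ (_ , tr , f) → DoC-；-split tr f) (λ (_ , doδ , doγ) → DoC-；-join doδ doγ)

  DoC-nil : {s s' : Sit S} → DoC {b = b} M nil s s' ⇔ (s ≡ s')
  DoC-nil = mk⇔ (λ { (_ , t*refl , _) → refl ; (_ , t*step () _ , _) })
                (λ { refl → nil , t*refl , fTest tt })

Executable-doL⁻ : {S : Sig} {M : Model S} {s : Sit S} (gs : List (GAct S)) →
  Executable M (doL gs s) → Executable M s
Executable-doL⁻ []       ex = ex
Executable-doL⁻ (g ∷ gs) ex with Executable-doL⁻ gs ex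
... | exDo ex′ _ = ex′

module _ {H L : Sig} (m : RefMap H L) (Mh : Model H) (Ml : Model L) where

  DoMs : GAct H → Sit L → Sit L → Set
  DoMs (A ⟨ ds , e ⟩) = Do Ml (e ∷ₑ lookup ds) (ms m A)

  DoMsSeq : List (GAct H) → Sit L → Sit L → Set
  DoMsSeq []       s s'' = s ≡ s''
  DoMsSeq (g ∷ gs) s s'' = Σ (Sit L) (λ s' → DoMs g s s' × DoMsSeq gs s' s'')

  Do-msAct : {n : ℕ} (v : Env n) (α : HAct H n) {s s' : Sit L} →
    Do Ml v (msAct m α) s s' ⇔ DoMs (groundA v α) s s'
  Do-msAct v (A , ts , e) {s} {s'} =
    ≡⇒⇔ (cong (λ δ → DoC Ml δ s s') (substP-fusion grounds (ms m A)))
    where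
      ground : (t : Term _) → substT (groundS v) t ≡ nm (evT v t)
      ground (var i) = refl
      ground (nm c)  = refl

      grounds : substT (groundS v) ∘ actS A ts e ≗ groundS (evT v e ∷ₑ lookup (vmap (evT v) ts))
      grounds zero    = ground e
      grounds (suc i) = trans (ground (lookup ts i)) (cong nm (sym (lookup-map i (evT v) ts)))

  Do-foldl : {n : ℕ} (v : Env n) (αs : List (HAct H n)) (δ : Prog L true n) {s s'' : Sit L} →
    Do Ml v (foldl (λ δ α → δ ； msAct m α) δ αs) s s''
      ⇔ Σ (Sit L) (λ s' → Do Ml v δ s s' × DoMsSeq (lmap (groundA v) αs) s' s'')
  Do-foldl v []       δ = mk⇔ (λ doδ → _ , doδ , refl) (λ { (_ , doδ , refl) → doδ })
  Do-foldl v (α ∷ αs) δ = mk⇔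
    (λ doₗ → let (s₂ , doδα , run) = Equivalence.to (Do-foldl v αs (δ ； msAct m α)) doₗ
                 (s₁ , doδ , doα)  = Equivalence.to (DoC-； Ml) doδα
             in s₁ , doδ , s₂ , Equivalence.to (Do-msAct v α) doα , run)
    (λ (s₁ , doδ , s₂ , doα , run) → Equivalence.from (Do-foldl v αs (δ ； msAct m α))
      (s₂ , Equivalence.from (DoC-； Ml) (s₁ , doδ , Equivalence.from (Do-msAct v α) doα) , run))

  Do-msSeq : {n : ℕ} (v : Env n) (αs : List (HAct H n)) {s s' : Sit L} →
    Do Ml v (msSeq m αs) s s' ⇔ DoMsSeq (lmap (groundA v) αs) s s'
  Do-msSeq v αs = mk⇔
    (λ doₗ → let (_ , doNil , run) = Equivalence.to (Do-foldl v αs nil) doₗ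
             in subst (λ s → DoMsSeq _ s _) (sym (Equivalence.to (DoC-nil {b = true} Ml) doNil)) run)
    (λ run → Equivalence.from (Do-foldl v αs nil) (_ , Equivalence.from (DoC-nil {b = true} Ml) refl , run))

  Sim⇒Sat-mfF : {sh : Sit H} {sl : Sit L} → Sim m Mh Ml sh sl →
    {n : ℕ} (v : Env n) (φ : Fm H n) → Sat Mh v sh φ ⇔ Sat Ml v sl (mfF m φ)
  Sim⇒Sat-mfF sim v ⊤ₘ = ⇔-id _
  Sim⇒Sat-mfF {sl = sl} sim v (flu F ts) =
    ⇔-sym (Sat-substF Ml sl (λ i → lookup-map i (evT v) ts) (mf m F)) ⇔-∘ sim F (vmap (evT v) ts)
  Sim⇒Sat-mfF sim v (t ≐ u)  = ⇔-id _
  Sim⇒Sat-mfF sim v (¬ₘ φ)   = ¬-cong-⇔ (Sim⇒Sat-mfF sim v φ)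
  Sim⇒Sat-mfF sim v (φ ∧ₘ ψ) = Sim⇒Sat-mfF sim v φ ×-⇔ Sim⇒Sat-mfF sim v ψ
  Sim⇒Sat-mfF sim v (∃ₘ φ)   = Σ-⇔ (λ d → Sim⇒Sat-mfF sim (d ∷ₑ v) φ)

  module _ {B : Sit H → Sit L → Set} (isB : IsBisim m Mh Ml B) where

    bisim-forth : {sh : Sit H} {sl : Sit L} → B sh sl → (g : GAct H) → Poss Mh g sh →
      Σ (Sit L) (λ sl' → DoMs g sl sl' × B (doA g sh) sl')
    bisim-forth b (A ⟨ ds , e ⟩) = proj₁ (proj₂ (isB _ _ b)) A ds e

    bisim-back : {sh : Sit H} {sl sl' : Sit L} → B sh sl → (g : GAct H) → DoMs g sl sl' →
      Poss Mh g sh × B (doA g sh) sl'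
    bisim-back b (A ⟨ ds , e ⟩) = proj₂ (proj₂ (isB _ _ b)) A ds e _

    bisim-simulate : (gs : List (GAct H)) {sh : Sit H} {sl : Sit L} → B sh sl →
      Executable Mh (doL gs sh) → Σ (Sit L) (λ sl' → DoMsSeq gs sl sl' × B (doL gs sh) sl')
    bisim-simulate []       b ex = _ , refl , b
    bisim-simulate (g ∷ gs) b ex with Executable-doL⁻ gs ex
    ... | exDo _ poss =
      let sl₁ , doMs , b₁ = bisim-forth b g poss
          sl' , run , b'  = bisim-simulate gs b₁ ex
      in sl' , (sl₁ , doMs , run) , b'

    bisim-reflect : (gs : List (GAct H)) {sh : Sit H} {sl sl' : Sit L} → B sh sl →
      Executable Mh sh → DoMsSeq gs sl sl' → Executable Mh (doL gs sh) × B (doL gs sh) sl'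
    bisim-reflect []       b ex refl = ex , b
    bisim-reflect (g ∷ gs) b ex (_ , doMs , run) =
      let poss , b₁ = bisim-back b g doMs in bisim-reflect gs b₁ (exDo ex poss) run

    bisim-transfer : {P : Sit H → Set} {Q : Sit L → Set} →
      (∀ {sh sl} → B sh sl → P sh ⇔ Q sl) →
      {sh : Sit H} {sl : Sit L} → B sh sl → Executable Mh sh → (gs : List (GAct H)) →
      Σ (Sit L) (λ sl' → DoMsSeq gs sl sl' × Q sl') ⇔ (Executable Mh (doL gs sh) × P (doL gs sh))
    bisim-transfer P⇔Q b ex gs = mk⇔
      (λ (_ , run , q) → let ex' , b' = bisim-reflect gs b ex run in ex' , Equivalence.from (P⇔Q b') q)
      (λ (ex' , p) → let sl' , run , b' = bisim-simulate gs b ex' in sl' , run , Equivalence.to (P⇔Q b') p)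

theorem4 : (na nf : ℕ) (aA : Fin na → ℕ) (aF : Fin nf → ℕ) (L : Sig)
    (Th : Theory (finSig na nf aA aF)) (Tl : Theory L) →
    IsNDBAT Th → IsNDBAT Tl →
    (m : RefMap (finSig na nf aA aF) L) → IsSDMap Tl m → Proper Tl m →
    (Mh : Model (finSig na nf aA aF)) (Ml : Model L) → Th Mh → Tl Ml →
    Bisimilar m Mh Ml →
    (n : ℕ) (αs : List (HAct (finSig na nf aA aF) n))
    (φ : Fm (finSig na nf aA aF) n) (v : Env n) →
    Σ (Sit L) (λ s' → Do Ml v (msSeq m αs) S₀ s' × Sat Ml v s' (mfF m φ))
    ⇔ (Executable Mh (doL (lmap (groundA v) αs) S₀)
    × Sat Mh v (doL (lmap (groundA v) αs) S₀) φ)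
theorem4 na nf aA aF L Th Tl _ _ m _ _ Mh Ml _ _ (B , isB , b₀) n αs φ v =
  bisim-transfer m Mh Ml isB Sat⇔Sat-mfF b₀ exS₀ (lmap (groundA v) αs)
    ⇔-∘ Σ-⇔ (λ _ → Do-msSeq m Mh Ml v αs ×-⇔ ⇔-id _)
  where
    Sat⇔Sat-mfF : ∀ {sh sl} → B sh sl → Sat Mh v sh φ ⇔ Sat Ml v sl (mfF m φ)
    Sat⇔Sat-mfF b = Sim⇒Sat-mfF m Mh Ml (proj₁ (isB _ _ b)) v φ
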